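{- For every non-empty $B\subset\mathbb{N}$, there exist $k\ge2$ and a $k$-ary function $S:\mathbb{N}^k\to\mathbb{Z}$ with additive structure such that $\langle B,S\rangle$ is an $\mathbb{N}$-Induction Model.
   Context: $\mathbb{N}=\{1,2,\dots\}$. $S$ has additive structure if $S(x_1,\dots,x_k)=a_0+a_1x_1+\dots+a_kx_k$ with $a_i\in\mathbb{Z}$ and $a_i\neq0$ for $1\le i\le k$. $\langle B,S\rangle$ is an $\mathbb{N}$-Induction Model if every $G\subseteq\mathbb{N}$ with $B\subseteq G$ and such that $x_1,\dots,x_k\in G$, $S(x_1,\dots,x_k)\in\mathbb{N}$ imply $S(x_1,\dots,x_k)\in G$, satisfies $G=\mathbb{N}$. -}

module Defs where

open import Data.Nat using (ℕ; zero; suc; _≤_)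
open import Data.Integer using (ℤ; +_; _+_; _*_; _<_) renaming (0ℤ to 0ℤ)
open import Data.Fin using (Fin; zero; suc)
open import Data.Product using (Σ; ∃; _×_; _,_)
open import Relation.Binary.PropositionalEquality using (_≡_; _≢_)
open import Relation.Unary using (Pred; _⊆_)
open import Level using (0ℓ)

-- Paper's ℕ = {1,2,...}; we model it inside Agda's ℕ via the predicate Pos.
Pos : Pred ℕ 0ℓ
Pos n = 1 ≤ n

sumFin : (k : ℕ) → (Fin k → ℤ) → ℤ
sumFin zero    f = + 0
sumFin (suc k) f = f zero + sumFin k (λ i → f (suc i))

AdditiveStructure : (k : ℕ) → ((Fin k → ℕ) → ℤ) → Set
AdditiveStructure k S =
  Σ ℤ λ a₀ → Σ (Fin k → ℤ) λ a →
    (∀ i → a i ≢ + 0) × (∀ x → S x ≡ a₀ + sumFin k (λ i → a i * + (x i)))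

-- ⟨B,S⟩ is an ℕ-Induction Model: every G ⊆ ℕ containing B and closed under S
-- (whenever x₁..x_k ∈ G and S(x) ∈ ℕ, then S(x) ∈ G) equals ℕ.
-- "S(x) ∈ ℕ and S(x) ∈ G" is rendered as: S x ≡ + m, with m positive and G m.
InductionModel : (k : ℕ) → Pred ℕ 0ℓ → ((Fin k → ℕ) → ℤ) → Set₁
InductionModel k B S =
  (G : Pred ℕ 0ℓ) →
  G ⊆ Pos →
  B ⊆ G →
  (∀ (x : Fin k → ℕ) → (∀ i → G (x i)) → ∀ m → Pos m → S x ≡ + m → G m) →
  ∀ n → Pos n → G n

-- Take S(x, y, z) = 1 + x + y − z and some b ∈ B. Since S(n, b, b) = n + 1, every G
-- containing b and closed under S contains all n ≥ b; for 1 ≤ n < b the argument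
-- b + (b − n) + 1 is such an n, and S(b, b, b + (b − n) + 1) = n.
module Submission where

open import Defs
open import Data.Nat using (ℕ; zero; suc; _+_; _∸_; _≤_; z≤n; s≤s)
open import Data.Nat.Properties using (≤-total; m∸n+n≡m; +-suc; +-comm)
import Data.Nat.Tactic.RingSolver as ℕ-Ring
open import Data.Integer using (ℤ)
import Data.Integer as Z
import Data.Integer.Tactic.RingSolver as ℤ-Ring
open import Data.Fin using (Fin; zero; suc)
open import Data.Vec.Functional using (_∷_; [])
open import Data.Product using (Σ; ∃; _×_; _,_)
open import Data.Sum using (inj₁; inj₂)
open import Relation.Binary.PropositionalEquality
open import Relation.Unary using (Pred; _⊆_)
open import Level using (0ℓ)

affine : ∀ {k} → ℤ → (Fin k → ℤ) → (Fin k → ℕ) → ℤ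
affine {k} a₀ a x = a₀ Z.+ sumFin k (λ i → a i Z.* Z.+ x i)

affine-additive : ∀ {k} a₀ (a : Fin k → ℤ) →
                  (∀ i → a i ≢ Z.+ 0) → AdditiveStructure k (affine a₀ a)
affine-additive a₀ a a≢0 = a₀ , a , a≢0 , λ _ → refl

S₃-coefficients : Fin 3 → ℤ
S₃-coefficients = Z.+ 1 ∷ Z.+ 1 ∷ Z.-[1+ 0 ] ∷ []

S₃ : (Fin 3 → ℕ) → ℤ
S₃ = affine (Z.+ 1) S₃-coefficients

S₃-additive : AdditiveStructure 3 S₃
S₃-additive = affine-additive (Z.+ 1) S₃-coefficients
  λ { zero () ; (suc zero) () ; (suc (suc zero)) () }

S₃-value : ∀ x y z m → z + m ≡ suc (x + y) → S₃ (x ∷ y ∷ z ∷ []) ≡ Z.+ m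
S₃-value x y z m eq = begin
  S₃ (x ∷ y ∷ z ∷ [])                     ≡⟨ unfold (Z.+ x) (Z.+ y) (Z.+ z) ⟩
  Z.+ 1 Z.+ (Z.+ x Z.+ Z.+ y) Z.- Z.+ z   ≡⟨ cong (λ n → Z.+ n Z.- Z.+ z) (sym eq) ⟩
  Z.+ z Z.+ Z.+ m Z.- Z.+ z               ≡⟨ cancel (Z.+ z) (Z.+ m) ⟩
  Z.+ m                                   ∎
  where
  open ≡-Reasoning
  unfold : ∀ i j k → Z.+ 1 Z.+ (Z.+ 1 Z.* i Z.+ (Z.+ 1 Z.* j Z.+ (Z.-[1+ 0 ] Z.* k Z.+ Z.+ 0)))
                   ≡ Z.+ 1 Z.+ (i Z.+ j) Z.- k
  unfold = ℤ-Ring.solve-∀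
  cancel : ∀ i j → i Z.+ j Z.- i ≡ j
  cancel = ℤ-Ring.solve-∀

ClosedUnder : ∀ {k} → ((Fin k → ℕ) → ℤ) → Pred ℕ 0ℓ → Set
ClosedUnder {k} S G = ∀ (x : Fin k → ℕ) → (∀ i → G (x i)) → ∀ m → Pos m → S x ≡ Z.+ m → G m

module _ {G : Pred ℕ 0ℓ} (closed : ClosedUnder S₃ G) where

  S₃-closed : ∀ {x y z m} → G x → G y → G z → z + suc m ≡ suc (x + y) → G (suc m)
  S₃-closed {x} {y} {z} {m} Gx Gy Gz eq =
    closed (x ∷ y ∷ z ∷ []) (λ { zero → Gx ; (suc zero) → Gy ; (suc (suc zero)) → Gz })
           (suc m) (s≤s z≤n) (S₃-value x y z (suc m) eq)

  closed-above : ∀ {b} → G b → ∀ d → G (d + b)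
  closed-above Gb zero        = Gb
  closed-above {b} Gb (suc d) =
    S₃-closed (closed-above Gb d) Gb Gb (trans (+-suc b (d + b)) (cong suc (+-comm b (d + b))))

  closed-below : ∀ {j m} → G (j + suc m) → G (suc m)
  closed-below {j} {m} Gb = S₃-closed Gb Gb (closed-above Gb (suc j)) (rearrange j m)
    where
    rearrange : ∀ j m → suc j + (j + suc m) + suc m ≡ suc (j + suc m + (j + suc m))
    rearrange = ℕ-Ring.solve-∀

  closed-everywhere : ∀ {b} → G b → ∀ n → Pos n → G n
  closed-everywhere Gb zero ()
  closed-everywhere {b} Gb (suc m) _ with ≤-total b (suc m)
  ... | inj₁ b≤n = subst G (m∸n+n≡m b≤n) (closed-above Gb (suc m ∸ b))
  ... | inj₂ n≤b = closed-below (subst G (sym (m∸n+n≡m n≤b)) Gb)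

lemma7 : (B : Pred ℕ 0ℓ) → B ⊆ Pos → (∃ λ b → B b) →
    Σ ℕ λ k → (2 ≤ k) × (Σ ((Fin k → ℕ) → ℤ) λ S →
      AdditiveStructure k S × InductionModel k B S)
lemma7 B _ (b , b∈B) =
  3 , s≤s (s≤s z≤n) , S₃ , S₃-additive ,
  λ G _ B⊆G closed → closed-everywhere closed (B⊆G b∈B)
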